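{- Let $G$ be a connected graph with $\mathrm{col}(G)=d\geq 3$, let $M=K_1\vee G$, and let $w$ be the vertex of $M$ corresponding to $K_1$. Let $\mathcal{H}=(L,H)$ be an $m$-fold cover of $M$ with $m\geq d+3$ such that $E_H(L(u),L(v))$ is a perfect matching whenever $uv\in E(M)$, and write $L(w)=\{(w,j):j\in[m]\}$. If $L(w)$ contains at least $m-1$ level vertices, then there is a natural bijection between the $\mathcal{H}$-colorings of $M$ and the proper $m$-colorings of $M$; consequently $P_{DP}(M,\mathcal{H})=P(M,m)$.
   Context: All graphs are finite and simple; $[m]=\{1,\dots,m\}$. $K_1\vee G$ is the join of a single vertex with $G$. The coloring number $\mathrm{col}(G)$ is the smallest integer $d$ for which there is an ordering of $V(G)$ in which each vertex has at most $d-1$ neighbors preceding it. $P(M,m)$ denotes the number of proper $m$-colorings of $M$. A cover of a graph $G$ is a pair $\mathcal{H}=(L,H)$ where $H$ is a graph and $L:V(G)\to\mathcal{P}(V(H))$ satisfies: (1) the sets $L(u)$ partition $V(H)$; (2) each $H[L(u)]$ is complete; (3) if $E_H(L(u),L(v))$ is nonempty then $u=v$ or $uv\in E(G)$; (4) if $uv\in E(G)$ then $E_H(L(u),L(v))$ is a matching. Here $E_H(S,U)$ is the set of edges of $H$ with one endpoint in $S$ and one in $U$. The cover is $m$-fold if all $|L(u)|=m$. An $\mathcal{H}$-coloring is an independent set of $H$ of size $|V(G)|$; $P_{DP}(G,\mathcal{H})$ is their number. There is a natural bijection between the $\mathcal{H}$-colorings of $M$ and the proper $m$-colorings of $M$ if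 the elements of each $L(v)$ can be named $L(v)=\{(v,j):j\in[m]\}$ so that whenever $xy\in E(M)$, $(x,j)$ and $(y,j)$ are adjacent in $H$ for every $j\in[m]$. For $j\in[m]$ and $v\in V(G)$ set $H^{(j)}=H-N_H[(w,j)]$ and $L^{(j)}(v)=L(v)\setminus N_H((w,j))$; then $(L^{(j)},H^{(j)})$ is an $(m-1)$-fold cover of $G$. Edges of $H^{(j)}$ joining distinct sets $L^{(j)}(u)$, $L^{(j)}(v)$ ($u\ne v$ in $V(G)$) are cross-edges. A vertex $(w,t)\in L(w)$ is a level vertex if $H^{(t)}$ contains exactly $|E(G)|(m-1)$ cross-edges. -}

module Defs where

open import Data.Nat using (ℕ; zero; suc; _+_; _*_; _∸_; _≤_; _<ᵇ_; _≡ᵇ_)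
open import Data.Bool using (Bool; true; false; _∧_; not; if_then_else_)
open import Data.Fin using (Fin; zero; suc; toℕ)
open import Data.Fin.Permutation using (Permutation′; _⟨$⟩ʳ_)
open import Data.List using (List; []; _∷_; map; concatMap)
open import Data.Nat.ListAction using (sum)
open import Data.Product using (_×_; _,_; Σ)
open import Function.Definitions using (Injective)
open import Relation.Binary.PropositionalEquality using (_≡_; _≢_)

countFin : ∀ {k} → (Fin k → Bool) → ℕ
countFin {zero}  p = 0
countFin {suc k} p = (if p zero then 1 else 0) + countFin (λ i → p (suc i))

sumFin : ∀ {k} → (Fin k → ℕ) → ℕ
sumFin {zero}  f = 0
sumFin {suc k} f = f zero + sumFin (λ i → f (suc i))

allFin? : ∀ {k} → (Fin k → Bool) → Bool
allFin? {zero}  p = true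
allFin? {suc k} p = p zero ∧ allFin? (λ i → p (suc i))

countL : ∀ {A : Set} → (A → Bool) → List A → ℕ
countL p xs = sum (map (λ x → if p x then 1 else 0) xs)

allFuns : ∀ {A : Set} (k : ℕ) → List A → List (Fin k → A)
allFuns zero    xs = (λ ()) ∷ []
allFuns (suc k) xs =
  concatMap (λ x → map (λ f → λ { zero → x ; (suc i) → f i }) (allFuns k xs)) xs

allFinList : (k : ℕ) → List (Fin k)
allFinList zero    = []
allFinList (suc k) = zero ∷ map suc (allFinList k)

record Graph (n : ℕ) : Set where
  field
    adj    : Fin n → Fin n → Bool
    sym    : ∀ u v → adj u v ≡ adj v u
    irrefl : ∀ u → adj u u ≡ false
open Graph public

numEdges : ∀ {n} → Graph n → ℕ
numEdges G = sumFin (λ u → countFin (λ v → (toℕ u <ᵇ toℕ v) ∧ adj G u v))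

data Reachable {n} (G : Graph n) : Fin n → Fin n → Set where
  here : ∀ {u} → Reachable G u u
  step : ∀ {u x v} → adj G u x ≡ true → Reachable G x v → Reachable G u v

Connected : ∀ {n} → Graph n → Set
Connected G = ∀ u v → Reachable G u v

-- An ordering of V(G) is given by an injective position map pos : V(G) → Fin n.
-- HasColOrder G d : some ordering in which each vertex has at most d-1
-- neighbours preceding it.
HasColOrder : ∀ {n} → Graph n → ℕ → Set
HasColOrder {n} G d =
  Σ (Fin n → Fin n) λ pos → Injective _≡_ _≡_ pos ×
    (∀ v → countFin (λ u → adj G u v ∧ (toℕ (pos u) <ᵇ toℕ (pos v))) ≤ d ∸ 1)

ColoringNumber : ∀ {n} → Graph n → ℕ → Set
ColoringNumber G d = HasColOrder G d × (∀ d' → HasColOrder G d' → d ≤ d')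

-- M = K₁ ∨ G on Fin (suc n); vertex zero is w
joinAdj : ∀ {n} → Graph n → Fin (suc n) → Fin (suc n) → Bool
joinAdj G zero    zero    = false
joinAdj G zero    (suc v) = true
joinAdj G (suc u) zero    = true
joinAdj G (suc u) (suc v) = adj G u v

joinSym : ∀ {n} (G : Graph n) u v → joinAdj G u v ≡ joinAdj G v u
joinSym G zero    zero    = Relation.Binary.PropositionalEquality.refl
joinSym G zero    (suc v) = Relation.Binary.PropositionalEquality.refl
joinSym G (suc u) zero    = Relation.Binary.PropositionalEquality.refl
joinSym G (suc u) (suc v) = sym G u v

joinIrrefl : ∀ {n} (G : Graph n) u → joinAdj G u u ≡ false
joinIrrefl G zero    = Relation.Binary.PropositionalEquality.refl
joinIrrefl G (suc u) = irrefl G u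

K1∨ : ∀ {n} → Graph n → Graph (suc n)
K1∨ G = record { adj = joinAdj G ; sym = joinSym G ; irrefl = joinIrrefl G }

IsProperᵇ : ∀ {k m} → Graph k → (Fin k → Fin m) → Bool
IsProperᵇ M c =
  allFin? (λ u → allFin? (λ v → not (adj M u v ∧ (toℕ (c u) ≡ᵇ toℕ (c v)))))

chromPoly : ∀ {k} → Graph k → (m : ℕ) → ℕ
chromPoly {k} M m = countL (IsProperᵇ M) (allFuns k (allFinList m))

-- m-fold covers.  Since the sets L(u) partition V(H) and all have size m,
-- we take V(H) = V(M) × Fin m with L(u) = {u} × Fin m (WLOG up to renaming).

record Cover {k} (M : Graph k) (m : ℕ) : Set where
  field
    hadj    : Fin k × Fin m → Fin k × Fin m → Bool
    hsym    : ∀ p q → hadj p q ≡ hadj q p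
    hirrefl : ∀ p → hadj p p ≡ false
    clique  : ∀ u i j → i ≢ j → hadj (u , i) (u , j) ≡ true
    onEdges : ∀ u v i j → u ≢ v → hadj (u , i) (v , j) ≡ true → adj M u v ≡ true
    matchR  : ∀ u v → adj M u v ≡ true → ∀ i j j' →
              hadj (u , i) (v , j) ≡ true → hadj (u , i) (v , j') ≡ true → j ≡ j'
    matchL  : ∀ u v → adj M u v ≡ true → ∀ i i' j →
              hadj (u , i) (v , j) ≡ true → hadj (u , i') (v , j) ≡ true → i ≡ i'
open Cover public

-- E_H(L(u),L(v)) is a perfect matching whenever uv ∈ E(M)
-- (together with matchR/matchL and symmetry of adj M)
PerfectMatchings : ∀ {k m} {M : Graph k} → Cover M m → Set
PerfectMatchings {k} {m} {M} 𝓗 =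
  ∀ u v → adj M u v ≡ true → ∀ i → Σ (Fin m) λ j → hadj 𝓗 (u , i) (v , j) ≡ true

-- H-colourings: independent sets of H of size |V(M)|; subsets of V(H) are
-- encoded as characteristic functions Fin k → Fin m → Bool.
subsetSize : ∀ {k m} → (Fin k → Fin m → Bool) → ℕ
subsetSize S = sumFin (λ u → countFin (S u))

IsIndepᵇ : ∀ {k m} {M : Graph k} → Cover M m → (Fin k → Fin m → Bool) → Bool
IsIndepᵇ 𝓗 S =
  allFin? λ u → allFin? λ i → allFin? λ v → allFin? λ j →
    not (S u i ∧ S v j ∧ hadj 𝓗 (u , i) (v , j))

IsHColouringᵇ : ∀ {k m} {M : Graph k} → Cover M m → (Fin k → Fin m → Bool) → Bool
IsHColouringᵇ {k} 𝓗 S = IsIndepᵇ 𝓗 S ∧ (subsetSize S ≡ᵇ k)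

P-DP : ∀ {k m} {M : Graph k} → Cover M m → ℕ
P-DP {k} {m} 𝓗 = countL (IsHColouringᵇ 𝓗) (allFuns k (allFuns m (true ∷ false ∷ [])))

-- (suc u , i) survives in H^{(t)} iff it is not adjacent to (w , t)
survives : ∀ {n m} {G : Graph n} → Cover (K1∨ G) m → Fin m → Fin n → Fin m → Bool
survives 𝓗 t u i = not (hadj 𝓗 (zero , t) (suc u , i))

crossEdges : ∀ {n m} {G : Graph n} → Cover (K1∨ G) m → Fin m → ℕ
crossEdges 𝓗 t =
  sumFin λ u → sumFin λ v → sumFin λ i → countFin λ j →
    (toℕ u <ᵇ toℕ v) ∧ survives 𝓗 t u i ∧ survives 𝓗 t v j ∧
    hadj 𝓗 (suc u , i) (suc v , j)

isLevelᵇ : ∀ {n m} {G : Graph n} → Cover (K1∨ G) m → Fin m → Bool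
isLevelᵇ {n} {m} {G} 𝓗 t = crossEdges 𝓗 t ≡ᵇ (numEdges G * (m ∸ 1))

numLevel : ∀ {n m} {G : Graph n} → Cover (K1∨ G) m → ℕ
numLevel 𝓗 = countFin (isLevelᵇ 𝓗)

-- Natural bijection: a renaming of each L(v) by a permutation σ_v, so that
-- the paper's (v , j) is our (v , σ_v j), with (x,j)(y,j) ∈ E(H) for all
-- xy ∈ E(M), j ∈ [m].
NaturalNaming : ∀ {k m} {M : Graph k} → Cover M m → Set
NaturalNaming {k} {m} {M} 𝓗 =
  Σ (Fin k → Permutation′ m) λ σ →
    ∀ x y → adj M x y ≡ true → ∀ j →
      hadj 𝓗 (x , σ x ⟨$⟩ʳ j) (y , σ y ⟨$⟩ʳ j) ≡ true

module Submission where

-- Write w = zero for the apex of M = K₁ ∨ G and, for t ∈ [m] and a vertex u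
-- of G, let partner u t be the vertex of L(u) matched to (w , t).  Deleting
-- N_H[(w , t)] leaves m - 1 vertices in every L(u), so every edge uv of G
-- carries at most m - 1 cross-edges of H^(t); hence (w , t) is level iff
-- every edge carries exactly m - 1 of them, and that forces (u , partner u t)
-- and (v , partner v t) to be adjacent ("t is aligned at uv").  Misaligned
-- colours come in pairs, so when at most one colour is non-level, every
-- colour is aligned at every edge, and the renaming j ↦ partner u j of each
-- L(u) is a natural naming of the cover.

open import Defs hiding (sym)
open import Data.Nat using (ℕ; zero; suc; _+_; _*_; _∸_; _≤_; _<_; z≤n; s≤s; _<ᵇ_; _≡ᵇ_)
open import Data.Nat.Properties
  using (≤-reflexive; ≤-trans; ≤-antisym; n≤1+n; m≤n+m; +-mono-≤; +-monoˡ-≤; +-monoʳ-≤;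
         +-cancelˡ-≡; +-cancelʳ-≤; +-identityʳ; +-suc; +-comm; *-distribʳ-+; ∸-monoˡ-≤;
         m+n∸n≡m; 1+n≰n; <⇒≢; <⇒<ᵇ; <ᵇ⇒<; ≡ᵇ⇒≡; ≡⇒≡ᵇ; <-cmp; +-0-commutativeMonoid)
open import Data.Nat.ListAction using (sum)
open import Data.Nat.ListAction.Properties using (sum-++)
open import Data.Bool using (Bool; true; false; _∧_; not; if_then_else_)
open import Data.Bool.Properties using (⇔→≡; ¬-not; ∧-identityʳ; not-involutive; T-≡)
open import Data.Fin using (Fin; zero; suc; toℕ; _≟_)
open import Data.Fin.Properties using (toℕ-injective; suc-injective)
open import Data.Fin.Permutation using (Permutation′; _⟨$⟩ʳ_; _⟨$⟩ˡ_; inverseˡ; permutation)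
import Data.Fin.Permutation as Permutation
open import Data.Vec.Functional using () renaming (_∷_ to _∷ᶠ_)
open import Data.List using (List; []; _∷_; map; concatMap; _++_)
open import Data.List.Properties using (map-++; map-∘; map-cong)
open import Data.Product using (_×_; _,_; Σ; proj₁; proj₂)
open import Data.Empty using (⊥; ⊥-elim)
open import Function.Bundles using (mk⇔; Equivalence)
open import Relation.Nullary using (¬_; yes; no; contradiction)
open import Relation.Binary using (tri<; tri≈; tri>)
open import Relation.Binary.PropositionalEquality
import Algebra.Properties.CommutativeMonoid.Sum as CommutativeMonoidSum

private
  variable
    k m : ℕ

ind : Bool → ℕ
ind b = if b then 1 else 0

bool-ext : ∀ {a b} → (a ≡ true → b ≡ true) → (b ≡ true → a ≡ true) → a ≡ b
bool-ext to from = ⇔→≡ (mk⇔ to from)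

∧-split : ∀ {a b} → a ∧ b ≡ true → a ≡ true × b ≡ true
∧-split {true} b≡true = refl , b≡true

not-true : ∀ {b} → not b ≡ true → b ≡ false
not-true {false} _ = refl

not-false : ∀ {b} → not b ≡ false → b ≡ true
not-false {true} _ = refl

true≢false : true ≢ false
true≢false ()

not-∧₃-elim : ∀ {a b c} → not (a ∧ b ∧ c) ≡ true → a ≡ true → b ≡ true → c ≡ false
not-∧₃-elim {c = false} _ refl refl = refl

not-∧₃-intro : ∀ {a b c} → (a ≡ true → b ≡ true → c ≡ false) → not (a ∧ b ∧ c) ≡ true
not-∧₃-intro {false} _ = refl
not-∧₃-intro {true} {false} _ = refl
not-∧₃-intro {true} {true} h rewrite h refl refl = refl

∧₃-false : ∀ {a b c} → c ≡ false → a ∧ b ∧ c ≡ false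
∧₃-false {false} _ = refl
∧₃-false {true} {false} _ = refl
∧₃-false {true} {true} c≡false = c≡false

≡ᵇ-refl : ∀ x → (x ≡ᵇ x) ≡ true
≡ᵇ-refl x = Equivalence.to T-≡ (≡⇒≡ᵇ x x refl)

-- Equality test on Fin m; eqᵇ j is also the characteristic function of {j}.
eqᵇ : Fin m → Fin m → Bool
eqᵇ a b = toℕ a ≡ᵇ toℕ b

eqᵇ-refl : (a : Fin m) → eqᵇ a a ≡ true
eqᵇ-refl a = ≡ᵇ-refl (toℕ a)

eqᵇ⇒≡ : (a b : Fin m) → eqᵇ a b ≡ true → a ≡ b
eqᵇ⇒≡ a b h = toℕ-injective (≡ᵇ⇒≡ (toℕ a) (toℕ b) (Equivalence.from T-≡ h))

allFin?-elim : {p : Fin k → Bool} → allFin? p ≡ true → ∀ i → p i ≡ true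
allFin?-elim {p = p} h zero = proj₁ (∧-split {p zero} h)
allFin?-elim {p = p} h (suc i) = allFin?-elim (proj₂ (∧-split {p zero} h)) i

allFin?-intro : {p : Fin k → Bool} → (∀ i → p i ≡ true) → allFin? p ≡ true
allFin?-intro {zero} h = refl
allFin?-intro {suc k} h rewrite h zero = allFin?-intro (λ i → h (suc i))

allFin?-cong : {p q : Fin k → Bool} → (∀ i → p i ≡ q i) → allFin? p ≡ allFin? q
allFin?-cong {zero} e = refl
allFin?-cong {suc k} e = cong₂ _∧_ (e zero) (allFin?-cong (λ i → e (suc i)))

sumFin-cong : {f g : Fin k → ℕ} → (∀ i → f i ≡ g i) → sumFin f ≡ sumFin g
sumFin-cong {zero} e = refl
sumFin-cong {suc k} e = cong₂ _+_ (e zero) (sumFin-cong (λ i → e (suc i)))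

sumFin-mono : {f g : Fin k → ℕ} → (∀ i → f i ≤ g i) → sumFin f ≤ sumFin g
sumFin-mono {zero} h = z≤n
sumFin-mono {suc k} h = +-mono-≤ (h zero) (sumFin-mono (λ i → h (suc i)))

sumFin-zero : {f : Fin k → ℕ} → (∀ i → f i ≡ 0) → sumFin f ≡ 0
sumFin-zero {zero} h = refl
sumFin-zero {suc k} h rewrite h zero = sumFin-zero (λ i → h (suc i))

sumFin-ones : sumFin {k} (λ _ → 1) ≡ k
sumFin-ones {zero} = refl
sumFin-ones {suc k} = cong suc (sumFin-ones {k})

sumFin-tight : {f g : Fin k → ℕ} → (∀ i → f i ≤ g i) → sumFin f ≡ sumFin g → ∀ i → f i ≡ g i
sumFin-tight {suc k} {f} {g} f≤g sums≡ = termwise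
  where
  rest≤ : sumFin (λ i → f (suc i)) ≤ sumFin (λ i → g (suc i))
  rest≤ = sumFin-mono (λ i → f≤g (suc i))
  head≡ : f zero ≡ g zero
  head≡ = ≤-antisym (f≤g zero)
    (+-cancelʳ-≤ _ (g zero) (f zero) (≤-trans (≤-reflexive (sym sums≡)) (+-monoʳ-≤ (f zero) rest≤)))
  rest≡ : sumFin (λ i → f (suc i)) ≡ sumFin (λ i → g (suc i))
  rest≡ = +-cancelˡ-≡ (f zero) _ _ (trans sums≡ (cong (_+ _) (sym head≡)))
  termwise : ∀ i → f i ≡ g i
  termwise zero = head≡
  termwise (suc i) = sumFin-tight (λ i → f≤g (suc i)) rest≡ i

sumFin-*ʳ : (f : Fin k → ℕ) (c : ℕ) → sumFin f * c ≡ sumFin (λ i → f i * c)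
sumFin-*ʳ {zero} f c = refl
sumFin-*ʳ {suc k} f c =
  trans (*-distribʳ-+ c (f zero) _) (cong (f zero * c +_) (sumFin-*ʳ (λ i → f (suc i)) c))

module ℕSum = CommutativeMonoidSum +-0-commutativeMonoid

sumFin≡sum : (f : Fin k → ℕ) → sumFin f ≡ ℕSum.sum f
sumFin≡sum {zero} f = refl
sumFin≡sum {suc k} f = cong (f zero +_) (sumFin≡sum (λ i → f (suc i)))

sumFin-permute : (π : Permutation′ m) (f : Fin m → ℕ) → sumFin f ≡ sumFin (λ i → f (π ⟨$⟩ʳ i))
sumFin-permute π f =
  trans (sumFin≡sum f) (trans (ℕSum.sum-permute f π) (sym (sumFin≡sum (λ i → f (π ⟨$⟩ʳ i)))))

AtMostOne : (Fin k → Bool) → Set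
AtMostOne p = ∀ i j → p i ≡ true → p j ≡ true → i ≡ j

countFin-as-sum : (p : Fin k → Bool) → countFin p ≡ sumFin (λ i → ind (p i))
countFin-as-sum {zero} p = refl
countFin-as-sum {suc k} p = cong (ind (p zero) +_) (countFin-as-sum (λ i → p (suc i)))

countFin-cong : {p q : Fin k → Bool} → (∀ i → p i ≡ q i) → countFin p ≡ countFin q
countFin-cong {zero} e = refl
countFin-cong {suc k} e = cong₂ _+_ (cong ind (e zero)) (countFin-cong (λ i → e (suc i)))

countFin-*ʳ : (p : Fin k → Bool) (c : ℕ) → countFin p * c ≡ sumFin (λ i → if p i then c else 0)
countFin-*ʳ {zero} p c = refl
countFin-*ʳ {suc k} p c with p zero
... | true = cong (c +_) (countFin-*ʳ (λ i → p (suc i)) c)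
... | false = countFin-*ʳ (λ i → p (suc i)) c

countFin-zero : {p : Fin k → Bool} → (∀ i → p i ≡ false) → countFin p ≡ 0
countFin-zero {zero} h = refl
countFin-zero {suc k} h rewrite h zero = countFin-zero (λ i → h (suc i))

countFin-mono : {p q : Fin k → Bool} → (∀ i → p i ≡ true → q i ≡ true) → countFin p ≤ countFin q
countFin-mono {zero} h = z≤n
countFin-mono {suc k} {p} {q} h with p zero in p0 | q zero in q0
... | true | true = s≤s (countFin-mono (λ i → h (suc i)))
... | true | false = contradiction (trans (sym (h zero p0)) q0) λ ()
... | false | true = ≤-trans (countFin-mono (λ i → h (suc i))) (n≤1+n _)
... | false | false = countFin-mono (λ i → h (suc i))

countFin-complement : (p : Fin k → Bool) → countFin p + countFin (λ i → not (p i)) ≡ k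
countFin-complement {zero} p = refl
countFin-complement {suc k} p with p zero
... | true = cong suc (countFin-complement (λ i → p (suc i)))
... | false = trans (+-suc _ _) (cong suc (countFin-complement (λ i → p (suc i))))

countFin-atMostOne : {p : Fin k → Bool} → AtMostOne p → countFin p ≤ 1
countFin-atMostOne {zero} h = z≤n
countFin-atMostOne {suc k} {p} h with p zero in p0
... | true = ≤-reflexive (cong suc (countFin-zero (λ i → ¬-not (λ pi → 0≢suc (h zero (suc i) p0 pi)))))
  where
  0≢suc : ∀ {i : Fin k} → zero ≢ suc i
  0≢suc ()
... | false = countFin-atMostOne (λ i j pi pj → suc-injective (h (suc i) (suc j) pi pj))

countFin-witness : {p : Fin k → Bool} (a : Fin k) → p a ≡ true → 1 ≤ countFin p
countFin-witness {p = p} zero pa rewrite pa = s≤s z≤n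
countFin-witness {p = p} (suc a) pa = ≤-trans (countFin-witness a pa) (m≤n+m _ (ind (p zero)))

countFin-two : {p : Fin k → Bool} (a b : Fin k) → p a ≡ true → p b ≡ true → a ≢ b → 2 ≤ countFin p
countFin-two zero zero pa pb a≢b = contradiction refl a≢b
countFin-two zero (suc b) pa pb a≢b rewrite pa = s≤s (countFin-witness b pb)
countFin-two (suc a) zero pa pb a≢b rewrite pb = s≤s (countFin-witness a pa)
countFin-two {p = p} (suc a) (suc b) pa pb a≢b =
  ≤-trans (countFin-two a b pa pb (λ a≡b → a≢b (cong suc a≡b))) (m≤n+m _ (ind (p zero)))

countFin-exists : {p : Fin k → Bool} → 1 ≤ countFin p → Σ (Fin k) λ a → p a ≡ true
countFin-exists {suc k} {p} h with p zero in p0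
... | true = zero , p0
... | false = let (a , pa) = countFin-exists h in suc a , pa

Singleton : (Fin m → Bool) → Set
Singleton {m} x = Σ (Fin m) λ j → ∀ a → x a ≡ eqᵇ j a

countFin-singleton : (j : Fin m) → countFin (eqᵇ j) ≡ 1
countFin-singleton j = ≤-antisym
  (countFin-atMostOne {p = eqᵇ j} (λ a b ja jb → trans (sym (eqᵇ⇒≡ j a ja)) (eqᵇ⇒≡ j b jb)))
  (countFin-witness j (eqᵇ-refl j))

exactlyOne⇒singleton : {p : Fin m → Bool} → AtMostOne p → countFin p ≡ 1 → Singleton p
exactlyOne⇒singleton {p = p} unique one = a , λ b → bool-ext (to b) (from b)
  where
  a = proj₁ (countFin-exists {p = p} (≤-reflexive (sym one)))
  pa : p a ≡ true
  pa = proj₂ (countFin-exists {p = p} (≤-reflexive (sym one)))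
  to : ∀ b → p b ≡ true → eqᵇ a b ≡ true
  to b pb = subst (λ x → eqᵇ a x ≡ true) (unique a b pa pb) (eqᵇ-refl a)
  from : ∀ b → eqᵇ a b ≡ true → p b ≡ true
  from b ab = subst (λ x → p x ≡ true) (eqᵇ⇒≡ a b ab) pa

sumL : {A : Set} → (A → ℕ) → List A → ℕ
sumL F xs = sum (map F xs)

sumL-cong : {A : Set} {F G : A → ℕ} → (∀ x → F x ≡ G x) → ∀ xs → sumL F xs ≡ sumL G xs
sumL-cong e xs = cong sum (map-cong e xs)

sumL-zero : {A : Set} {F : A → ℕ} → (∀ x → F x ≡ 0) → ∀ xs → sumL F xs ≡ 0
sumL-zero e [] = refl
sumL-zero {F = F} e (x ∷ xs) rewrite e x = sumL-zero e xs

sumL-concatMap : {A B : Set} (F : B → ℕ) (h : A → List B) (xs : List A) →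
  sumL F (concatMap h xs) ≡ sumL (λ x → sumL F (h x)) xs
sumL-concatMap F h [] = refl
sumL-concatMap F h (x ∷ xs) = begin
  sum (map F (h x ++ concatMap h xs))         ≡⟨ cong sum (map-++ F (h x) (concatMap h xs)) ⟩
  sum (map F (h x) ++ map F (concatMap h xs)) ≡⟨ sum-++ (map F (h x)) _ ⟩
  sumL F (h x) + sumL F (concatMap h xs)      ≡⟨ cong (sumL F (h x) +_) (sumL-concatMap F h xs) ⟩
  sumL F (h x) + sumL (λ x → sumL F (h x)) xs ∎
  where open ≡-Reasoning

sumL-map : {A B : Set} (F : B → ℕ) (h : A → B) (xs : List A) → sumL F (map h xs) ≡ sumL (λ x → F (h x)) xs
sumL-map F h xs = cong sum (sym (map-∘ xs))

sumL-allFinList : (F : Fin k → ℕ) → sumL F (allFinList k) ≡ sumFin F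
sumL-allFinList {zero} F = refl
sumL-allFinList {suc k} F =
  cong (F zero +_) (trans (sumL-map F suc (allFinList k)) (sumL-allFinList (λ i → F (suc i))))

Extensional : {A C : Set} → ((Fin k → A) → C) → Set
Extensional {k} F = ∀ {f g : Fin k → _} → (∀ i → f i ≡ g i) → F f ≡ F g

Extensional₂ : {C : Set} → ((Fin k → Fin m → Bool) → C) → Set
Extensional₂ {k} {m} F = ∀ {S T : Fin k → Fin m → Bool} → (∀ u a → S u a ≡ T u a) → F S ≡ F T

sumL-allFuns-suc : {A : Set} (xs : List A) (F : (Fin (suc k) → A) → ℕ) → Extensional F →
  sumL F (allFuns (suc k) xs) ≡ sumL (λ x → sumL (λ f → F (x ∷ᶠ f)) (allFuns k xs)) xs
sumL-allFuns-suc {k} xs F ext =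
  trans (sumL-concatMap F _ xs)
        (sumL-cong (λ x → trans (sumL-map F _ (allFuns k xs))
                                (sumL-cong (λ f → ext (λ { zero → refl ; (suc i) → refl })) (allFuns k xs))) xs)

sumL-colourings-suc : (F : (Fin (suc k) → Fin m) → ℕ) → Extensional F →
  sumL F (allFuns (suc k) (allFinList m)) ≡ sumFin (λ j → sumL (λ c → F (j ∷ᶠ c)) (allFuns k (allFinList m)))
sumL-colourings-suc {k} {m} F ext =
  trans (sumL-allFuns-suc (allFinList m) F ext) (sumL-allFinList (λ j → sumL (λ c → F (j ∷ᶠ c)) (allFuns k (allFinList m))))

sumL-allFuns-zero : {A : Set} (xs : List A) (F : (Fin 0 → A) → ℕ) → Extensional F →
  ∀ (f : Fin 0 → A) → sumL F (allFuns 0 xs) ≡ F f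
sumL-allFuns-zero xs F ext f = trans (+-identityʳ _) (ext (λ ()))

bools : List Bool
bools = true ∷ false ∷ []

subsets : (m : ℕ) → List (Fin m → Bool)
subsets m = allFuns m bools

sum-over-subsets-empty : (F : (Fin m → Bool) → ℕ) → Extensional F →
  (∀ x a → x a ≡ true → F x ≡ 0) → sumL F (subsets m) ≡ F (λ _ → false)
sum-over-subsets-empty {zero} F ext vanish = sumL-allFuns-zero bools F ext _
sum-over-subsets-empty {suc m} F ext vanish = begin
  sumL F (subsets (suc m))
    ≡⟨ sumL-allFuns-suc bools F ext ⟩
  sumL (λ x → F (true ∷ᶠ x)) (subsets m) + (sumL (λ x → F (false ∷ᶠ x)) (subsets m) + 0)
    ≡⟨ cong₂ _+_ (sumL-zero (λ x → vanish (true ∷ᶠ x) zero refl) (subsets m)) (+-identityʳ _) ⟩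
  sumL (λ x → F (false ∷ᶠ x)) (subsets m)
    ≡⟨ sum-over-subsets-empty (λ x → F (false ∷ᶠ x)) (λ e → ext (λ { zero → refl ; (suc i) → e i }))
                              (λ x a xa → vanish (false ∷ᶠ x) (suc a) xa) ⟩
  F (false ∷ᶠ (λ _ → false))
    ≡⟨ ext (λ { zero → refl ; (suc i) → refl }) ⟩
  F (λ _ → false) ∎
  where open ≡-Reasoning

sum-over-subsets-singletons : (F : (Fin m → Bool) → ℕ) → Extensional F →
  (∀ x → ¬ Singleton x → F x ≡ 0) → sumL F (subsets m) ≡ sumFin (λ j → F (eqᵇ j))
sum-over-subsets-singletons {zero} F ext vanish =
  trans (sumL-allFuns-zero bools F ext (λ ())) (vanish (λ ()) λ { (() , _) })
sum-over-subsets-singletons {suc m} F ext vanish = begin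
  sumL F (subsets (suc m))
    ≡⟨ sumL-allFuns-suc bools F ext ⟩
  sumL (λ x → F (true ∷ᶠ x)) (subsets m) + (sumL (λ x → F (false ∷ᶠ x)) (subsets m) + 0)
    ≡⟨ cong₂ _+_ with-zero (trans (+-identityʳ _) without-zero) ⟩
  F (eqᵇ zero) + sumFin (λ j → F (eqᵇ (suc j))) ∎
  where
  open ≡-Reasoning
  two-elements : ∀ (x : Fin m → Bool) a → x a ≡ true → ¬ Singleton (true ∷ᶠ x)
  two-elements x a xa (zero , q) with () ← trans (sym xa) (q (suc a))
  two-elements x a xa (suc j , q) with () ← q zero
  singleton-tail : ∀ (x : Fin m → Bool) → Singleton (false ∷ᶠ x) → Singleton x
  singleton-tail x (zero , q) with () ← q zero
  singleton-tail x (suc j , q) = j , (λ a → q (suc a))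
  with-zero : sumL (λ x → F (true ∷ᶠ x)) (subsets m) ≡ F (eqᵇ zero)
  with-zero = trans
    (sum-over-subsets-empty (λ x → F (true ∷ᶠ x)) (λ e → ext (λ { zero → refl ; (suc i) → e i }))
                            (λ x a xa → vanish _ (two-elements x a xa)))
    (ext (λ { zero → refl ; (suc i) → refl }))
  realign : ∀ j → F (false ∷ᶠ eqᵇ j) ≡ F (eqᵇ (suc j))
  realign j = ext (λ { zero → refl ; (suc i) → refl })
  without-zero : sumL (λ x → F (false ∷ᶠ x)) (subsets m) ≡ sumFin (λ j → F (eqᵇ (suc j)))
  without-zero = trans
    (sum-over-subsets-singletons (λ x → F (false ∷ᶠ x)) (λ e → ext (λ { zero → refl ; (suc i) → e i }))
                                 (λ x ns → vanish _ (λ s → ns (singleton-tail x s))))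
    (sumFin-cong realign)

sum-over-transversals : (F : (Fin k → Fin m → Bool) → ℕ) → Extensional₂ F →
  (∀ S u → ¬ Singleton (S u) → F S ≡ 0) →
  sumL F (allFuns k (subsets m)) ≡ sumL (λ c → F (λ u → eqᵇ (c u))) (allFuns k (allFinList m))
sum-over-transversals {zero} {m} F ext vanish =
  trans (sumL-allFuns-zero (subsets m) F (λ e → ext (λ u a → cong (λ x → x a) (e u))) _)
        (sym (sumL-allFuns-zero (allFinList m) (λ c → F (λ u → eqᵇ (c u))) (λ e → ext (λ ())) (λ ())))
sum-over-transversals {suc k} {m} F ext vanish = begin
  sumL F (allFuns (suc k) (subsets m))
    ≡⟨ sumL-allFuns-suc (subsets m) F (λ e → ext (λ u a → cong (λ x → x a) (e u))) ⟩
  sumL first-member (subsets m)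
    ≡⟨ sum-over-subsets-singletons first-member
         (λ e → sumL-cong (λ S → ext (λ { zero a → e a ; (suc u) a → refl })) (allFuns k (subsets m)))
         (λ x ns → sumL-zero (λ S → vanish (x ∷ᶠ S) zero ns) (allFuns k (subsets m))) ⟩
  sumFin (λ j → first-member (eqᵇ j))
    ≡⟨ sumFin-cong (λ j → sum-over-transversals (λ S → F (eqᵇ j ∷ᶠ S))
                            (λ e → ext (λ { zero a → refl ; (suc u) a → e u a }))
                            (λ S u ns → vanish (eqᵇ j ∷ᶠ S) (suc u) ns)) ⟩
  sumFin (λ j → sumL (λ c → F (eqᵇ j ∷ᶠ (λ u → eqᵇ (c u)))) (allFuns k (allFinList m)))
    ≡⟨ sumFin-cong (λ j → sumL-cong (realign j) (allFuns k (allFinList m))) ⟩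
  sumFin (λ j → sumL (λ c → F (λ u → eqᵇ ((j ∷ᶠ c) u))) (allFuns k (allFinList m)))
    ≡⟨ sym (sumL-colourings-suc (λ c → F (λ u → eqᵇ (c u))) (λ e → ext (λ u a → cong (λ x → eqᵇ x a) (e u)))) ⟩
  sumL (λ c → F (λ u → eqᵇ (c u))) (allFuns (suc k) (allFinList m)) ∎
  where
  open ≡-Reasoning
  first-member : (Fin m → Bool) → ℕ
  first-member x = sumL (λ S → F (x ∷ᶠ S)) (allFuns k (subsets m))
  realign : ∀ j c → F (eqᵇ j ∷ᶠ (λ u → eqᵇ (c u))) ≡ F (λ u → eqᵇ ((j ∷ᶠ c) u))
  realign j c = ext (λ { zero a → refl ; (suc u) a → refl })

sum-relabel : (τ : Fin k → Permutation′ m) (F : (Fin k → Fin m) → ℕ) → Extensional F →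
  sumL F (allFuns k (allFinList m)) ≡ sumL (λ c → F (λ u → τ u ⟨$⟩ʳ c u)) (allFuns k (allFinList m))
sum-relabel {zero} {m} τ F ext =
  trans (sumL-allFuns-zero (allFinList m) F ext _)
        (sym (sumL-allFuns-zero (allFinList m) (λ c → F (λ u → τ u ⟨$⟩ʳ c u)) (λ _ → ext (λ ())) (λ ())))
sum-relabel {suc k} {m} τ F ext = begin
  sumL F (allFuns (suc k) (allFinList m))
    ≡⟨ sumL-colourings-suc F ext ⟩
  sumFin (λ i → sumL (λ c → F (i ∷ᶠ c)) (allFuns k (allFinList m)))
    ≡⟨ sumFin-permute (τ zero) _ ⟩
  sumFin (λ j → sumL (λ c → F ((τ zero ⟨$⟩ʳ j) ∷ᶠ c)) (allFuns k (allFinList m)))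
    ≡⟨ sumFin-cong (λ j → sum-relabel (λ u → τ (suc u)) (λ c → F ((τ zero ⟨$⟩ʳ j) ∷ᶠ c))
                                      (λ e → ext (λ { zero → refl ; (suc u) → e u }))) ⟩
  sumFin (λ j → sumL (λ c → F ((τ zero ⟨$⟩ʳ j) ∷ᶠ (λ u → τ (suc u) ⟨$⟩ʳ c u))) (allFuns k (allFinList m)))
    ≡⟨ sumFin-cong (λ j → sumL-cong (realign j) (allFuns k (allFinList m))) ⟩
  sumFin (λ j → sumL (λ c → F (λ u → τ u ⟨$⟩ʳ (j ∷ᶠ c) u)) (allFuns k (allFinList m)))
    ≡⟨ sym (sumL-colourings-suc (λ c → F (λ u → τ u ⟨$⟩ʳ c u)) (λ e → ext (λ u → cong (τ u ⟨$⟩ʳ_) (e u)))) ⟩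
  sumL (λ c → F (λ u → τ u ⟨$⟩ʳ c u)) (allFuns (suc k) (allFinList m)) ∎
  where
  open ≡-Reasoning
  realign : ∀ j c → F ((τ zero ⟨$⟩ʳ j) ∷ᶠ (λ u → τ (suc u) ⟨$⟩ʳ c u)) ≡ F (λ u → τ u ⟨$⟩ʳ (j ∷ᶠ c) u)
  realign j c = ext (λ { zero → refl ; (suc u) → refl })

module Colourings {M : Graph k} (𝓗 : Cover M m) where

  independent-no-edge : ∀ {S} → IsIndepᵇ 𝓗 S ≡ true →
    ∀ u i v j → S u i ≡ true → S v j ≡ true → hadj 𝓗 (u , i) (v , j) ≡ false
  independent-no-edge indep u i v j =
    not-∧₃-elim (allFin?-elim (allFin?-elim (allFin?-elim (allFin?-elim indep u) i) v) j)

  independent-intro : ∀ {S} →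
    (∀ u i v j → S u i ≡ true → S v j ≡ true → hadj 𝓗 (u , i) (v , j) ≡ false) → IsIndepᵇ 𝓗 S ≡ true
  independent-intro h =
    allFin?-intro λ u → allFin?-intro λ i → allFin?-intro λ v → allFin?-intro λ j → not-∧₃-intro (h u i v j)

  isHColouring-ext : Extensional₂ (IsHColouringᵇ 𝓗)
  isHColouring-ext e = cong₂ _∧_
    (allFin?-cong λ u → allFin?-cong λ i → allFin?-cong λ v → allFin?-cong λ j →
       cong not (cong₂ _∧_ (e u i) (cong (_∧ hadj 𝓗 (u , i) (v , j)) (e v j))))
    (cong (_≡ᵇ k) (sumFin-cong (λ u → countFin-cong (e u))))

  -- Each L(u) is a clique, so an H-colouring meets every L(u) in exactly one vertex.
  hColouring⇒transversal : ∀ S → IsHColouringᵇ 𝓗 S ≡ true → ∀ u → Singleton (S u)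
  hColouring⇒transversal S isH u = exactlyOne⇒singleton (atMostOne u) (exactlyOne u)
    where
    indep : IsIndepᵇ 𝓗 S ≡ true
    indep = proj₁ (∧-split isH)
    size : subsetSize S ≡ k
    size = ≡ᵇ⇒≡ _ k (Equivalence.from T-≡ (proj₂ (∧-split {IsIndepᵇ 𝓗 S} isH)))
    atMostOne : ∀ u → AtMostOne (S u)
    atMostOne u i j si sj with i ≟ j
    ... | yes i≡j = i≡j
    ... | no i≢j = ⊥-elim (true≢false (trans (sym (clique 𝓗 u i j i≢j)) (independent-no-edge {S} indep u i u j si sj)))
    exactlyOne : ∀ u → countFin (S u) ≡ 1
    exactlyOne = sumFin-tight (λ u → countFin-atMostOne {p = S u} (atMostOne u)) (trans size (sym sumFin-ones))

  module Named (σ : Fin k → Permutation′ m)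
    (natural : ∀ x y → adj M x y ≡ true → ∀ j → hadj 𝓗 (x , σ x ⟨$⟩ʳ j) (y , σ y ⟨$⟩ʳ j) ≡ true) where

    named : Fin k → Fin m → Fin m
    named u j = σ u ⟨$⟩ʳ j

    named-injective : ∀ u {a b} → named u a ≡ named u b → a ≡ b
    named-injective u {a} {b} e = trans (sym (inverseˡ (σ u))) (trans (cong (σ u ⟨$⟩ˡ_) e) (inverseˡ (σ u)))

    named-adjacency : ∀ (c : Fin k → Fin m) u v →
      hadj 𝓗 (u , named u (c u)) (v , named v (c v)) ≡ adj M u v ∧ eqᵇ (c u) (c v)
    named-adjacency c u v with adj M u v in uv | eqᵇ (c u) (c v) in same
    ... | true | true =
      subst (λ x → hadj 𝓗 (u , named u (c u)) (v , named v x) ≡ true) (eqᵇ⇒≡ (c u) (c v) same) (natural u v uv (c u))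
    ... | true | false = ¬-not different-colours
      where
      different-colours : hadj 𝓗 (u , named u (c u)) (v , named v (c v)) ≢ true
      different-colours h = true≢false (trans (sym (subst (λ x → eqᵇ (c u) x ≡ true) same-colour (eqᵇ-refl (c u)))) same)
        where
        same-colour : c u ≡ c v
        same-colour = sym (named-injective v (matchR 𝓗 u v uv _ _ _ h (natural u v uv (c u))))
    ... | false | _ = ¬-not (non-edge (u ≟ v))
      where
      non-edge : _ → hadj 𝓗 (u , named u (c u)) (v , named v (c v)) ≢ true
      non-edge (yes refl) h = true≢false (trans (sym h) (hirrefl 𝓗 _))
      non-edge (no u≢v) h = true≢false (trans (sym (onEdges 𝓗 u v _ _ u≢v h)) uv)

    colour-transversal : (Fin k → Fin m) → Fin k → Fin m → Bool
    colour-transversal c u = eqᵇ (named u (c u))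

    transversal-colouring : ∀ c → IsHColouringᵇ 𝓗 (colour-transversal c) ≡ IsProperᵇ M c
    transversal-colouring c = begin
      IsIndepᵇ 𝓗 (colour-transversal c) ∧ (subsetSize (colour-transversal c) ≡ᵇ k)
        ≡⟨ cong (IsIndepᵇ 𝓗 (colour-transversal c) ∧_) size ⟩
      IsIndepᵇ 𝓗 (colour-transversal c) ∧ true
        ≡⟨ ∧-identityʳ _ ⟩
      IsIndepᵇ 𝓗 (colour-transversal c)
        ≡⟨ bool-ext indep⇒proper proper⇒indep ⟩
      IsProperᵇ M c ∎
      where
      open ≡-Reasoning
      size : (subsetSize (colour-transversal c) ≡ᵇ k) ≡ true
      size = trans (cong (_≡ᵇ k) {y = k} (trans (sumFin-cong (λ u → countFin-singleton (named u (c u)))) sumFin-ones))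
                   (≡ᵇ-refl k)
      indep⇒proper : IsIndepᵇ 𝓗 (colour-transversal c) ≡ true → IsProperᵇ M c ≡ true
      indep⇒proper indep = allFin?-intro λ u → allFin?-intro λ v → cong not
        (trans (sym (named-adjacency c u v))
               (independent-no-edge {colour-transversal c} indep u _ v _
                 (eqᵇ-refl (named u (c u))) (eqᵇ-refl (named v (c v)))))
      proper⇒indep : IsProperᵇ M c ≡ true → IsIndepᵇ 𝓗 (colour-transversal c) ≡ true
      proper⇒indep proper = independent-intro {colour-transversal c} λ u i v j ui vj →
        subst₂ (λ x y → hadj 𝓗 (u , x) (v , y) ≡ false) (eqᵇ⇒≡ (named u (c u)) i ui) (eqᵇ⇒≡ (named v (c v)) j vj)
          (trans (named-adjacency c u v) (not-true (allFin?-elim (allFin?-elim proper u) v)))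

    -- H-colourings are the transversals named by proper colourings.
    count : P-DP 𝓗 ≡ chromPoly M m
    count = begin
      sumL (λ S → ind (IsHColouringᵇ 𝓗 S)) (allFuns k (subsets m))
        ≡⟨ sum-over-transversals _ (λ e → cong ind (isHColouring-ext e)) vanish ⟩
      sumL (λ c → ind (IsHColouringᵇ 𝓗 (λ u → eqᵇ (c u)))) (allFuns k (allFinList m))
        ≡⟨ sum-relabel σ _ (λ e → cong ind (isHColouring-ext (λ u a → cong (λ x → eqᵇ x a) (e u)))) ⟩
      sumL (λ c → ind (IsHColouringᵇ 𝓗 (colour-transversal c))) (allFuns k (allFinList m))
        ≡⟨ sumL-cong (λ c → cong ind (transversal-colouring c)) (allFuns k (allFinList m)) ⟩
      sumL (λ c → ind (IsProperᵇ M c)) (allFuns k (allFinList m)) ∎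
      where
      open ≡-Reasoning
      vanish : ∀ S u → ¬ Singleton (S u) → ind (IsHColouringᵇ 𝓗 S) ≡ 0
      vanish S u ns with IsHColouringᵇ 𝓗 S in isH
      ... | true = ⊥-elim (ns (hColouring⇒transversal S isH u))
      ... | false = refl

naturalNaming⇒P-DP : {M : Graph k} (𝓗 : Cover M m) → NaturalNaming 𝓗 → P-DP 𝓗 ≡ chromPoly M m
naturalNaming⇒P-DP 𝓗 (σ , natural) = Colourings.Named.count 𝓗 σ natural

complement-too-large : ∀ a b m → a + b ≡ m → 2 ≤ b → m ∸ 1 ≤ a → ⊥
complement-too-large a b m a+b≡m 2≤b m∸1≤a = 1+n≰n (≤-trans 1+a≤m∸1 m∸1≤a)
  where
  1+a≤m∸1 : suc a ≤ m ∸ 1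
  1+a≤m∸1 = ∸-monoˡ-≤ 1 (≤-trans (+-monoˡ-≤ a 2≤b) (≤-reflexive (trans (+-comm b a) a+b≡m)))

module LevelVertices {n m : ℕ} (G : Graph n) (𝓗 : Cover (K1∨ G) m) (pm : PerfectMatchings 𝓗) where

  partner : Fin n → Fin m → Fin m
  partner u t = proj₁ (pm zero (suc u) refl t)

  partner-edge : ∀ u t → hadj 𝓗 (zero , t) (suc u , partner u t) ≡ true
  partner-edge u t = proj₂ (pm zero (suc u) refl t)

  partner-unique : ∀ u t i → hadj 𝓗 (zero , t) (suc u , i) ≡ true → i ≡ partner u t
  partner-unique u t i h = matchR 𝓗 zero (suc u) refl t i (partner u t) h (partner-edge u t)

  partner⁻¹ : Fin n → Fin m → Fin m
  partner⁻¹ u i = proj₁ (pm (suc u) zero refl i)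

  partner⁻¹-edge : ∀ u i → hadj 𝓗 (zero , partner⁻¹ u i) (suc u , i) ≡ true
  partner⁻¹-edge u i = trans (hsym 𝓗 _ _) (proj₂ (pm (suc u) zero refl i))

  partner-inverseˡ : ∀ u t → partner⁻¹ u (partner u t) ≡ t
  partner-inverseˡ u t =
    matchL 𝓗 zero (suc u) refl _ t (partner u t) (partner⁻¹-edge u (partner u t)) (partner-edge u t)

  partner-inverseʳ : ∀ u i → partner u (partner⁻¹ u i) ≡ i
  partner-inverseʳ u i = sym (partner-unique u _ i (partner⁻¹-edge u i))

  partner-injective : ∀ u {s t} → partner u s ≡ partner u t → s ≡ t
  partner-injective u {s} {t} e =
    trans (sym (partner-inverseˡ u s)) (trans (cong (partner⁻¹ u) e) (partner-inverseˡ u t))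

  partnerPerm : Fin n → Permutation′ m
  partnerPerm u = permutation (partner u) (partner⁻¹ u) (partner-inverseʳ u) (partner-inverseˡ u)

  Aligned : Fin n → Fin n → Fin m → Bool
  Aligned u v t = hadj 𝓗 (suc u , partner u t) (suc v , partner v t)

  -- Exactly the partner of (w , t) is deleted from L(u) in H^(t).
  survivors : ∀ t u → countFin (survives 𝓗 t u) ≡ m ∸ 1
  survivors t u = begin
    countFin (survives 𝓗 t u)
      ≡⟨ sym (m+n∸n≡m _ 1) ⟩
    countFin (survives 𝓗 t u) + 1 ∸ 1
      ≡⟨ cong (λ x → countFin (survives 𝓗 t u) + x ∸ 1) (sym deleted) ⟩
    countFin (survives 𝓗 t u) + countFin (λ i → not (survives 𝓗 t u i)) ∸ 1
      ≡⟨ cong (_∸ 1) (countFin-complement (survives 𝓗 t u)) ⟩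
    m ∸ 1 ∎
    where
    open ≡-Reasoning
    deleted : countFin (λ i → not (survives 𝓗 t u i)) ≡ 1
    deleted = trans (countFin-cong (λ i → not-involutive (hadj 𝓗 (zero , t) (suc u , i))))
      (≤-antisym (countFin-atMostOne {p = λ i → hadj 𝓗 (zero , t) (suc u , i)} λ i j hi hj →
                    trans (partner-unique u t i hi) (sym (partner-unique u t j hj)))
                 (countFin-witness (partner u t) (partner-edge u t)))

  crossRow : Fin m → Fin n → Fin n → Fin m → ℕ
  crossRow t u v i = countFin λ j → survives 𝓗 t u i ∧ survives 𝓗 t v j ∧ hadj 𝓗 (suc u , i) (suc v , j)

  cross : Fin m → Fin n → Fin n → ℕ
  cross t u v = sumFin (crossRow t u v)

  crossRow-bound : ∀ t u v → adj G u v ≡ true → ∀ i → crossRow t u v i ≤ ind (survives 𝓗 t u i)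
  crossRow-bound t u v uv i with survives 𝓗 t u i
  ... | true = countFin-atMostOne λ j j' hj hj' →
          matchR 𝓗 (suc u) (suc v) uv i j j' (proj₂ (∧-split hj)) (proj₂ (∧-split hj'))
  ... | false = ≤-reflexive (countFin-zero {m} {λ _ → false} (λ _ → refl))

  cross-bound : ∀ t u v → adj G u v ≡ true → cross t u v ≤ m ∸ 1
  cross-bound t u v uv = ≤-trans (sumFin-mono (crossRow-bound t u v uv))
    (≤-reflexive (trans (sym (countFin-as-sum (survives 𝓗 t u))) (survivors t u)))

  cross-nonedge : ∀ t u v → u ≢ v → adj G u v ≡ false → cross t u v ≡ 0
  cross-nonedge t u v u≢v nonadj =
    sumFin-zero λ i → countFin-zero λ j → ∧₃-false {survives 𝓗 t u i} {survives 𝓗 t v j} (¬-not λ h →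
      true≢false (trans (sym (onEdges 𝓗 (suc u) (suc v) i j (λ e → u≢v (suc-injective e)) h)) nonadj))

  tight-keeps-edges : ∀ t u v → adj G u v ≡ true → cross t u v ≡ m ∸ 1 →
    ∀ i → survives 𝓗 t u i ≡ true → Σ (Fin m) λ j → survives 𝓗 t v j ≡ true × hadj 𝓗 (suc u , i) (suc v , j) ≡ true
  tight-keeps-edges t u v uv tight i alive = j , ∧-split (proj₂ (∧-split {survives 𝓗 t u i} row-j))
    where
    rows : ∀ i → crossRow t u v i ≡ ind (survives 𝓗 t u i)
    rows = sumFin-tight (crossRow-bound t u v uv) (trans tight (trans (sym (survivors t u)) (countFin-as-sum (survives 𝓗 t u))))
    kept = countFin-exists (≤-reflexive (sym (trans (rows i) (cong ind alive))))
    j = proj₁ kept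
    row-j = proj₂ kept

  across : ∀ u v → adj G u v ≡ true → Fin m → Fin m
  across u v uv j = proj₁ (pm (suc v) (suc u) (trans (Graph.sym G v u) uv) j)

  across-edge : ∀ u v (uv : adj G u v ≡ true) j → hadj 𝓗 (suc u , across u v uv j) (suc v , j) ≡ true
  across-edge u v uv j = trans (hsym 𝓗 _ _) (proj₂ (pm (suc v) (suc u) (trans (Graph.sym G v u) uv) j))

  -- The match in L(u) of (v , partner v t) has lost its only cross-edge in H^(t),
  -- so on a tight edge it must itself be deleted, i.e. be partner u t.
  tight⇒aligned : ∀ t u v → adj G u v ≡ true → cross t u v ≡ m ∸ 1 → Aligned u v t ≡ true
  tight⇒aligned t u v uv tight with survives 𝓗 t u (across u v uv (partner v t)) in alive
  ... | false = subst (λ x → hadj 𝓗 (suc u , x) (suc v , partner v t) ≡ true)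
                      (partner-unique u t _ (not-false alive)) (across-edge u v uv (partner v t))
  ... | true = ⊥-elim (true≢false (trans (sym j-survives)
                                          (subst (λ x → survives 𝓗 t v x ≡ false) (sym j≡partner) deleted)))
    where
    kept = tight-keeps-edges t u v uv tight _ alive
    j = proj₁ kept
    j-survives : survives 𝓗 t v j ≡ true
    j-survives = proj₁ (proj₂ kept)
    j≡partner : j ≡ partner v t
    j≡partner = matchR 𝓗 (suc u) (suc v) uv _ j (partner v t) (proj₂ (proj₂ kept)) (across-edge u v uv (partner v t))
    deleted : survives 𝓗 t v (partner v t) ≡ false
    deleted = cong not (partner-edge v t)

  -- crossEdges counts, for each ordered pair u < v, the cross-edges between
  -- L(u) and L(v); pairBound is the corresponding term of |E(G)| (m - 1).
  pairCross : Fin m → Fin n → Fin n → ℕ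
  pairCross t u v = sumFin λ i → countFin λ j →
    (toℕ u <ᵇ toℕ v) ∧ survives 𝓗 t u i ∧ survives 𝓗 t v j ∧ hadj 𝓗 (suc u , i) (suc v , j)

  pairBound : Fin n → Fin n → ℕ
  pairBound u v = if (toℕ u <ᵇ toℕ v) ∧ adj G u v then m ∸ 1 else 0

  pairCross-guarded : ∀ t u v → pairCross t u v ≡ (if toℕ u <ᵇ toℕ v then cross t u v else 0)
  pairCross-guarded t u v with toℕ u <ᵇ toℕ v
  ... | true = refl
  ... | false = sumFin-zero {m} λ i → countFin-zero {m} {λ _ → false} (λ _ → refl)

  pairCross-bound : ∀ t u v → pairCross t u v ≤ pairBound u v
  pairCross-bound t u v = subst (_≤ pairBound u v) (sym (pairCross-guarded t u v)) (by-order _ refl)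
    where
    by-adjacency : ∀ b → adj G u v ≡ b → u ≢ v → cross t u v ≤ (if b then m ∸ 1 else 0)
    by-adjacency true uv _ = cross-bound t u v uv
    by-adjacency false nonadj u≢v = ≤-reflexive (cross-nonedge t u v u≢v nonadj)
    by-order : ∀ b → (toℕ u <ᵇ toℕ v) ≡ b →
      (if b then cross t u v else 0) ≤ (if b ∧ adj G u v then m ∸ 1 else 0)
    by-order true u<v = by-adjacency _ refl λ e → <⇒≢ (<ᵇ⇒< _ _ (Equivalence.from T-≡ u<v)) (cong toℕ e)
    by-order false _ = z≤n

  numEdges-as-sum : numEdges G * (m ∸ 1) ≡ sumFin λ u → sumFin λ v → pairBound u v
  numEdges-as-sum = trans (sumFin-*ʳ (λ u → countFin (λ v → (toℕ u <ᵇ toℕ v) ∧ adj G u v)) (m ∸ 1))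
    (sumFin-cong λ u → countFin-*ʳ (λ v → (toℕ u <ᵇ toℕ v) ∧ adj G u v) (m ∸ 1))

  -- A level colour attains every bound, hence is aligned at every edge.
  level⇒aligned : ∀ {t u v} → isLevelᵇ 𝓗 t ≡ true → toℕ u < toℕ v → adj G u v ≡ true → Aligned u v t ≡ true
  level⇒aligned {t} {u} {v} level u<v uv = tight⇒aligned t u v uv (begin
    cross t u v                                          ≡⟨ cong (if_then cross t u v else 0) (sym ordered) ⟩
    (if toℕ u <ᵇ toℕ v then cross t u v else 0)          ≡⟨ sym (pairCross-guarded t u v) ⟩
    pairCross t u v                                      ≡⟨ sumFin-tight (pairCross-bound t u) row-sums v ⟩
    pairBound u v                                        ≡⟨ cong (λ b → if b ∧ adj G u v then m ∸ 1 else 0) ordered ⟩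
    (if adj G u v then m ∸ 1 else 0)                     ≡⟨ cong (if_then m ∸ 1 else 0) uv ⟩
    m ∸ 1 ∎)
    where
    open ≡-Reasoning
    ordered : (toℕ u <ᵇ toℕ v) ≡ true
    ordered = Equivalence.to T-≡ (<⇒<ᵇ u<v)
    row-sums : sumFin (pairCross t u) ≡ sumFin (pairBound u)
    row-sums = sumFin-tight (λ u → sumFin-mono (pairCross-bound t u))
      (trans (≡ᵇ⇒≡ _ _ (Equivalence.from T-≡ level)) numEdges-as-sum) u

  -- Misaligned colours come in pairs: if t is misaligned at uv, so is the colour
  -- s whose partner in L(u) is matched to (v , partner v t).
  misaligned-pair : ∀ {u v t} → adj G u v ≡ true → Aligned u v t ≡ false →
    Σ (Fin m) λ s → s ≢ t × Aligned u v s ≡ false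
  misaligned-pair {u} {v} {t} uv misaligned = s , s≢t , ¬-not s-not-aligned
    where
    s : Fin m
    s = partner⁻¹ u (across u v uv (partner v t))
    link : hadj 𝓗 (suc u , partner u s) (suc v , partner v t) ≡ true
    link = subst (λ i → hadj 𝓗 (suc u , i) (suc v , partner v t) ≡ true)
                 (sym (partner-inverseʳ u _)) (across-edge u v uv (partner v t))
    s≢t : s ≢ t
    s≢t s≡t = true≢false (trans (sym (subst (λ x → hadj 𝓗 (suc u , partner u x) (suc v , partner v t) ≡ true) s≡t link))
                                misaligned)
    s-not-aligned : Aligned u v s ≢ true
    s-not-aligned aligned = s≢t (partner-injective v (matchR 𝓗 (suc u) (suc v) uv _ _ _ aligned link))

  module _ (levels : m ∸ 1 ≤ numLevel 𝓗) where

    -- At most one colour is non-level, but a misaligned colour would come with a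
    -- second one, and neither is level.
    aligned-ordered : ∀ {u v} → toℕ u < toℕ v → adj G u v ≡ true → ∀ t → Aligned u v t ≡ true
    aligned-ordered {u} {v} u<v uv t with Aligned u v t in aligned
    ... | true = refl
    ... | false = ⊥-elim (complement-too-large _ _ m (countFin-complement (Aligned u v)) two-misaligned
                                                 (≤-trans levels levels≤aligned))
      where
      pair = misaligned-pair uv aligned
      two-misaligned : 2 ≤ countFin (λ t → not (Aligned u v t))
      two-misaligned = countFin-two t (proj₁ pair) (cong not aligned) (cong not (proj₂ (proj₂ pair)))
                                    (λ e → proj₁ (proj₂ pair) (sym e))
      levels≤aligned : numLevel 𝓗 ≤ countFin (Aligned u v)
      levels≤aligned = countFin-mono {p = isLevelᵇ 𝓗} {q = Aligned u v} λ t level → level⇒aligned level u<v uv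

    -- By symmetry of H the same holds for u > v; u = v is not an edge.
    aligned : ∀ u v → adj G u v ≡ true → ∀ t → Aligned u v t ≡ true
    aligned u v uv t with <-cmp (toℕ u) (toℕ v)
    ... | tri< u<v _ _ = aligned-ordered u<v uv t
    ... | tri≈ _ u≡v _ = ⊥-elim (true≢false (trans (sym uv) (subst (λ x → adj G u x ≡ false) (toℕ-injective u≡v) (irrefl G u))))
    ... | tri> _ _ v<u = trans (hsym 𝓗 _ _) (aligned-ordered v<u (trans (Graph.sym G v u) uv) t)

    naming : NaturalNaming 𝓗
    naming = σ , natural
      where
      σ : Fin (suc n) → Permutation′ m
      σ zero = Permutation.id
      σ (suc u) = partnerPerm u
      natural : ∀ x y → adj (K1∨ G) x y ≡ true → ∀ j → hadj 𝓗 (x , σ x ⟨$⟩ʳ j) (y , σ y ⟨$⟩ʳ j) ≡ true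
      natural zero (suc v) _ j = partner-edge v j
      natural (suc u) zero _ j = trans (hsym 𝓗 _ _) (partner-edge u j)
      natural (suc u) (suc v) uv j = aligned u v uv j

-- Lemma 5.1.
lemma5p1 : (n d m : ℕ) (G : Graph n) → Connected G → ColoringNumber G d → 3 ≤ d →
    d + 3 ≤ m → (𝓗 : Cover (K1∨ G) m) → PerfectMatchings 𝓗 →
    m ∸ 1 ≤ numLevel 𝓗 →
    NaturalNaming 𝓗 × (P-DP 𝓗 ≡ chromPoly (K1∨ G) m)
lemma5p1 n d m G _ _ _ _ 𝓗 pm levels = naming , naturalNaming⇒P-DP 𝓗 naming
  where
  naming : NaturalNaming 𝓗
  naming = LevelVertices.naming G 𝓗 pm levels
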